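{- Let $n\ge 2$ and let $h$ be a Hamiltonian cycle of $Q_n$ with chromatic vector $c(h)=(c_0,\ldots,c_{n-1})$. If $c_i>2^{n-2}$ for some $i$, then $h$ contains a square whose rims are $i$-th dimension edges; that is, there are two edges of $h$, both $i$-th dimension edges, which are opposite edges of a 4-cycle of $Q_n$.
   Context: $Q_n$ is the hypercube on $\{0,1\}^n$ (coordinates indexed $0,\ldots,n-1$), vertices adjacent iff they differ in exactly one coordinate; an $i$-th dimension edge is an edge whose endpoints differ in coordinate $i$. For a Hamiltonian cycle $h=h_0\cdots h_{2^n-1}$ (indices mod $2^n$), $c_i$ is the number of edges $\{h_\iota,h_{\iota+1}\}$ of $h$ that are $i$-th dimension edges. A 4-cycle $v_0v_1v_2v_3$ of $Q_n$ is a square inscribed in $h$ if there are indices $a,b$ with $h_ah_{a+1}h_bh_{b+1}=v_0v_1v_2v_3$ (straight square) or $=v_0v_1v_3v_2$ (twisted square); its rims are the edges $\{v_0,v_1\}$ and $\{v_2,v_3\}$. -}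

module Defs where

open import Data.Nat using (ℕ; suc; _^_; NonZero)
open import Data.Nat.Properties using (m^n≢0)
open import Data.Nat.DivMod using (_mod_)
open import Data.Bool using (Bool)
open import Data.Fin using (Fin; toℕ)
open import Data.Vec using (Vec; lookup)
open import Data.List using (List; length; filter)
open import Data.List using () renaming (allFin to allFinL)
open import Data.Product using (Σ; ∃; _×_; _,_)
open import Data.Sum using (_⊎_)
open import Function.Definitions using (Injective)
open import Relation.Binary.PropositionalEquality using (_≡_; _≢_)
open import Relation.Nullary using (Dec; yes; no; ¬_)
open import Relation.Nullary.Decidable using (_×-dec_; ¬?)
open import Data.Bool.Properties using () renaming (_≟_ to _≟B_)
open import Data.Fin.Properties using () renaming (_≟_ to _≟F_)
open import Data.Fin.Properties using (all?)

Vertex : ℕ → Set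
Vertex n = Vec Bool n

DimEdge : {n : ℕ} → Fin n → Vertex n → Vertex n → Set
DimEdge {n} i u v =
  (lookup u i ≢ lookup v i) × ((j : Fin n) → j ≢ i → lookup u j ≡ lookup v j)

dimEdge? : {n : ℕ} (i : Fin n) (u v : Vertex n) → Dec (DimEdge i u v)
dimEdge? i u v =
  ¬? (lookup u i ≟B lookup v i)
  ×-dec all? (λ j → ((j ≟F i) →-dec' (lookup u j ≟B lookup v j)))
  where
  _→-dec'_ : {P Q : Set} → Dec P → Dec Q → Dec (¬ P → Q)
  _ →-dec' yes q = yes (λ _ → q)
  yes p →-dec' no ¬q = yes (λ ¬p → Data.Empty.⊥-elim (¬p p))
    where import Data.Empty
  no ¬p →-dec' no ¬q = no (λ f → ¬q (f ¬p))

Adj : {n : ℕ} → Vertex n → Vertex n → Set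
Adj {n} u v = ∃ λ (i : Fin n) → DimEdge i u v

next : (n : ℕ) → Fin (2 ^ n) → Fin (2 ^ n)
next n ι = _mod_ (suc (toℕ ι)) (2 ^ n) {{m^n≢0 2 n}}

-- Hamiltonian cycle h_0 ... h_{2^n - 1} of Q_n (indices mod 2^n):
-- an injective (hence bijective) enumeration of the vertices with
-- consecutive entries adjacent.
IsHamCycle : (n : ℕ) → (Fin (2 ^ n) → Vertex n) → Set
IsHamCycle n h = Injective _≡_ _≡_ h × ((ι : Fin (2 ^ n)) → Adj (h ι) (h (next n ι)))

colourCount : (n : ℕ) → (Fin (2 ^ n) → Vertex n) → Fin n → ℕ
colourCount n h i =
  length (filter (λ ι → dimEdge? i (h ι) (h (next n ι))) (allFinL (2 ^ n)))

Is4Cycle : {n : ℕ} → Vertex n → Vertex n → Vertex n → Vertex n → Set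
Is4Cycle v0 v1 v2 v3 =
  (v0 ≢ v1) × (v0 ≢ v2) × (v0 ≢ v3) × (v1 ≢ v2) × (v1 ≢ v3) × (v2 ≢ v3) ×
  Adj v0 v1 × Adj v1 v2 × Adj v2 v3 × Adj v3 v0

-- h contains a square inscribed in h whose rims are i-th dimension edges:
-- indices a, b with h_a h_{a+1} h_b h_{b+1} a 4-cycle (straight) or
-- h_a h_{a+1} h_{b+1} h_b a 4-cycle (twisted); rims {h_a,h_{a+1}},{h_b,h_{b+1}}.
HasSquareWithRims : (n : ℕ) → (Fin (2 ^ n) → Vertex n) → Fin n → Set
HasSquareWithRims n h i =
  Σ (Fin (2 ^ n)) λ a → Σ (Fin (2 ^ n)) λ b →
    DimEdge i (h a) (h (next n a)) × DimEdge i (h b) (h (next n b)) ×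
    (Is4Cycle (h a) (h (next n a)) (h b) (h (next n b))
     ⊎ Is4Cycle (h a) (h (next n a)) (h (next n b)) (h b))

-- Delete from every vertex the coordinate i and one further coordinate j. The
-- starting points of the cᵢ > 2^(n-2) edges of direction i then fall into at
-- most 2^(n-2) classes, so by pigeonhole two distinct ones, h_a and h_b, agree
-- outside {i, j}. If they differ at j, the edges h_a h_{a+1} and h_b h_{b+1}
-- are opposite sides of a 4-cycle whose other sides are j-edges, straight or
-- twisted according to whether h_a and h_b also differ at i. If they agree at
-- j, then h_b = h_{a+1} and h_{b+1} = h_a, which forces a + 2 ≡ a mod 2^n,
-- impossible since 2^n ≥ 4.
module Submission where

open import Defs
open import Data.Nat using (ℕ; _≤_; _<_; _^_; _∸_)
open import Data.Fin using (Fin)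

open import Data.Nat.Base using (zero; suc; _+_; _*_; _%_; NonZero; z≤n; s≤s)
open import Data.Nat.Properties
  using (m^n≢0; +-comm; +-cancelˡ-≡; m≤m+n; ≤-trans; ^-monoʳ-≤)
open import Data.Nat.DivMod using (_mod_; _/_; m≡m%n+[m/n]*n; m%n%n≡m%n; %-distribˡ-+)
open import Data.Fin.Base using (zero; suc; toℕ; punchIn; punchOut; funToFin; finToFun)
  renaming (_<_ to _<ᶠ_)
open import Data.Fin.Properties
  using (punchIn-punchOut; punchInᵢ≢i; toℕ-fromℕ<; 2↔Bool; finToFun-funToFin; pigeonhole)
  renaming (_≟_ to _≟ᶠ_)
open import Data.Bool.Base using (Bool)
open import Data.Bool.Properties using (¬-not) renaming (_≟_ to _≟ᵇ_)
open import Data.Vec.Base using (lookup)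
open import Data.Vec.Properties using (tabulate∘lookup; tabulate-cong)
open import Data.List.Base as List using (List; filter; length)
open import Data.List.Base using () renaming (allFin to allFinL)
open import Data.List.Relation.Unary.All as All using ()
open import Data.List.Relation.Unary.AllPairs using (AllPairs; _∷_)
open import Data.List.Relation.Unary.Unique.Propositional.Properties using (filter⁺; allFin⁺)
open import Data.List.Membership.Propositional.Properties using (∈-filter⁻; ∈-lookup)
open import Data.Product.Base using (∃; _×_; _,_; proj₁; proj₂)
open import Data.Sum.Base using (_⊎_; inj₁; inj₂)
open import Function.Base using (_∘_)
open import Function.Definitions using (Injective)
open import Function.Bundles using (Injection; _↣_)
open import Function.Properties.Inverse using (↔-sym; ↔⇒↣)
open import Relation.Binary.Core using (Rel)
open import Relation.Unary using (Decidable)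
open import Relation.Binary.PropositionalEquality
open import Relation.Nullary using (¬_; yes; no; contradiction)

≢-≢⇒≡ : {x y z : Bool} → x ≢ y → y ≢ z → x ≡ z
≢-≢⇒≡ x≢y y≢z = trans (¬-not x≢y) (sym (¬-not (y≢z ∘ sym)))

lookup-ext : ∀ {n} {u v : Vertex n} → (∀ l → lookup u l ≡ lookup v l) → u ≡ v
lookup-ext {u = u} {v} eq =
  trans (sym (tabulate∘lookup u)) (trans (tabulate-cong eq) (tabulate∘lookup v))

AllPairs-lookup : ∀ {a r} {A : Set a} {R : Rel A r} {xs : List A} → AllPairs R xs →
  ∀ {x y : Fin (length xs)} → x <ᶠ y → R (List.lookup xs x) (List.lookup xs y)
AllPairs-lookup (Rx ∷ _)   {zero}  {suc y} _         = All.lookup Rx (∈-lookup y)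
AllPairs-lookup (_ ∷ Rxs) {suc x} {suc y} (s≤s x<y) = AllPairs-lookup Rxs x<y

suc-%-% : ∀ m M .{{_ : NonZero M}} → suc (m % M) % M ≡ suc m % M
suc-%-% m M = begin
  (1 + m % M) % M         ≡⟨ %-distribˡ-+ 1 (m % M) M ⟩
  (1 % M + m % M % M) % M ≡⟨ cong (λ x → (1 % M + x) % M) (m%n%n≡m%n m M) ⟩
  (1 % M + m % M) % M     ≡⟨ %-distribˡ-+ 1 m M ⟨
  (1 + m) % M             ∎
  where open ≡-Reasoning

module _ (M : ℕ) .{{_ : NonZero M}} where

  sucMod : Fin M → Fin M
  sucMod ι = suc (toℕ ι) mod M

  toℕ-sucMod : ∀ ι → toℕ (sucMod ι) ≡ suc (toℕ ι) % M
  toℕ-sucMod ι = toℕ-fromℕ< _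

  -- (2 + t) % M ≡ t forces 2 = q * M with q the quotient, impossible for M ≥ 3.
  sucMod∘sucMod≢id : 3 ≤ M → ∀ ι → sucMod (sucMod ι) ≢ ι
  sucMod∘sucMod≢id 3≤M ι eq = q*M≢2 ((2 + t) / M) (sym 2≡q*M)
    where
    t = toℕ ι
    [2+t]%M≡t : (2 + t) % M ≡ t
    [2+t]%M≡t = begin
      suc (suc t) % M     ≡⟨ suc-%-% (suc t) M ⟨
      suc (suc t % M) % M ≡⟨ cong (λ x → suc x % M) (toℕ-sucMod ι) ⟨
      suc (toℕ (sucMod ι)) % M ≡⟨ toℕ-sucMod (sucMod ι) ⟨
      toℕ (sucMod (sucMod ι)) ≡⟨ cong toℕ eq ⟩
      t                   ∎
      where open ≡-Reasoning
    2≡q*M : 2 ≡ (2 + t) / M * M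
    2≡q*M = +-cancelˡ-≡ t _ _ (begin
      t + 2               ≡⟨ +-comm t 2 ⟩
      2 + t               ≡⟨ m≡m%n+[m/n]*n (2 + t) M ⟩
      (2 + t) % M + (2 + t) / M * M ≡⟨ cong (_+ (2 + t) / M * M) [2+t]%M≡t ⟩
      t + (2 + t) / M * M ∎)
      where open ≡-Reasoning
    q*M≢2 : ∀ q → q * M ≢ 2
    q*M≢2 zero    ()
    q*M≢2 (suc q) eq = 3≰2 (subst (3 ≤_) eq (≤-trans 3≤M (m≤m+n M (q * M))))
      where
      3≰2 : ¬ 3 ≤ 2
      3≰2 (s≤s (s≤s ()))

module _ {n : ℕ} where

  dimEdge⇒≢ : ∀ {i} {u v : Vertex n} → DimEdge i u v → u ≢ v
  dimEdge⇒≢ {i} (uᵢ≢vᵢ , _) u≡v = uᵢ≢vᵢ (cong (λ w → lookup w i) u≡v)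

  dimEdge-sym : ∀ {i} {u v : Vertex n} → DimEdge i u v → DimEdge i v u
  dimEdge-sym (differ , agree) = differ ∘ sym , λ l l≢i → sym (agree l l≢i)

  dimEdge-keeps : ∀ {i j} {u v : Vertex n} → i ≢ j → DimEdge i u v → lookup u j ≡ lookup v j
  dimEdge-keeps i≢j (_ , uv) = uv _ (i≢j ∘ sym)

  dimEdge-dimEdge⇒≢ : ∀ {i j} {u v w : Vertex n} → i ≢ j →
                      DimEdge i u v → DimEdge j v w → u ≢ w
  dimEdge-dimEdge⇒≢ {i} {v = v} {w} i≢j (uᵢ≢vᵢ , _) vw u≡w =
    uᵢ≢vᵢ (trans (cong (λ x → lookup x i) u≡w)
                 (sym (dimEdge-keeps {u = v} {v = w} (i≢j ∘ sym) vw)))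

  dimEdges⇒4Cycle : ∀ {i j} {a b c d : Vertex n} → i ≢ j →
    DimEdge i a b → DimEdge j b c → DimEdge i c d → DimEdge j d a → Is4Cycle a b c d
  dimEdges⇒4Cycle {i} {j} {b = b} {c} i≢j ab bc cd da =
    dimEdge⇒≢ ab , dimEdge-dimEdge⇒≢ {v = b} i≢j ab bc , dimEdge⇒≢ da ∘ sym ,
    dimEdge⇒≢ bc , dimEdge-dimEdge⇒≢ {v = c} (i≢j ∘ sym) bc cd , dimEdge⇒≢ cd ,
    (i , ab) , (j , bc) , (i , cd) , (j , da)

  record AgreeOutside (i j : Fin n) (u v : Vertex n) : Set where
    constructor agreeOutside
    field agree : ∀ l → l ≢ i → l ≢ j → lookup u l ≡ lookup v l

  module _ {i j : Fin n} where

    agreeOutside-sym : ∀ {u v} → AgreeOutside i j u v → AgreeOutside i j v u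
    agreeOutside-sym (agreeOutside uv) = agreeOutside λ l l≢i l≢j → sym (uv l l≢i l≢j)

    agreeOutside-trans : ∀ {u v w} →
      AgreeOutside i j u v → AgreeOutside i j v w → AgreeOutside i j u w
    agreeOutside-trans (agreeOutside uv) (agreeOutside vw) =
      agreeOutside λ l l≢i l≢j → trans (uv l l≢i l≢j) (vw l l≢i l≢j)

    dimEdge⇒agreeOutside : ∀ {u v} → DimEdge i u v → AgreeOutside i j u v
    dimEdge⇒agreeOutside (_ , uv) = agreeOutside λ l l≢i _ → uv l l≢i

    agreeOutside⇒≡ : ∀ {u v} → AgreeOutside i j u v →
      lookup u i ≡ lookup v i → lookup u j ≡ lookup v j → u ≡ v
    agreeOutside⇒≡ {u} {v} (agreeOutside uv) uᵢ≡vᵢ uⱼ≡vⱼ = lookup-ext agree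
      where
      agree : ∀ l → lookup u l ≡ lookup v l
      agree l with l ≟ᶠ i | l ≟ᶠ j
      ... | yes refl | _        = uᵢ≡vᵢ
      ... | no _     | yes refl = uⱼ≡vⱼ
      ... | no l≢i   | no l≢j   = uv l l≢i l≢j

    agreeOutside⇒dimEdge : ∀ {u v} → AgreeOutside i j u v →
      lookup u i ≡ lookup v i → lookup u j ≢ lookup v j → DimEdge j u v
    agreeOutside⇒dimEdge {u} {v} (agreeOutside uv) uᵢ≡vᵢ uⱼ≢vⱼ = uⱼ≢vⱼ , agree
      where
      agree : ∀ l → l ≢ j → lookup u l ≡ lookup v l
      agree l l≢j with l ≟ᶠ i
      ... | yes refl = uᵢ≡vᵢ
      ... | no l≢i   = uv l l≢i l≢j

  module _ {i j : Fin n} {p q r s : Vertex n} (i≢j : i ≢ j)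
           (pq : DimEdge i p q) (rs : DimEdge i r s) where

    private
      q~p : AgreeOutside i j q p
      q~p = agreeOutside-sym (dimEdge⇒agreeOutside pq)

      r~s : AgreeOutside i j r s
      r~s = dimEdge⇒agreeOutside rs

      pⱼ≡qⱼ : lookup p j ≡ lookup q j
      pⱼ≡qⱼ = dimEdge-keeps {u = p} {v = q} i≢j pq

      rⱼ≡sⱼ : lookup r j ≡ lookup s j
      rⱼ≡sⱼ = dimEdge-keeps {u = r} {v = s} i≢j rs

    -- If p and r agree at j, then p = s and q = r: one edge traversed both ways.
    parallelEdges⇒square : AgreeOutside i j p r → p ≢ r → ¬ (p ≡ s × q ≡ r) →
                           Is4Cycle p q r s ⊎ Is4Cycle p q s r
    parallelEdges⇒square p~r p≢r ¬reversed
      with lookup p i ≟ᵇ lookup r i | lookup p j ≟ᵇ lookup r j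
    ... | yes pᵢ≡rᵢ | yes pⱼ≡rⱼ = contradiction (agreeOutside⇒≡ p~r pᵢ≡rᵢ pⱼ≡rⱼ) p≢r
    ... | no pᵢ≢rᵢ  | yes pⱼ≡rⱼ = contradiction (p≡s , q≡r) ¬reversed
      where
      p≡s : p ≡ s
      p≡s = agreeOutside⇒≡ (agreeOutside-trans p~r r~s)
              (≢-≢⇒≡ pᵢ≢rᵢ (proj₁ rs)) (trans pⱼ≡rⱼ rⱼ≡sⱼ)
      q≡r : q ≡ r
      q≡r = agreeOutside⇒≡ (agreeOutside-trans q~p p~r)
              (≢-≢⇒≡ (proj₁ pq ∘ sym) pᵢ≢rᵢ) (trans (sym pⱼ≡qⱼ) pⱼ≡rⱼ)
    ... | no pᵢ≢rᵢ  | no pⱼ≢rⱼ = inj₁ (dimEdges⇒4Cycle i≢j pq qr rs sp)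
      where
      qr : DimEdge j q r
      qr = agreeOutside⇒dimEdge (agreeOutside-trans q~p p~r)
             (≢-≢⇒≡ (proj₁ pq ∘ sym) pᵢ≢rᵢ) (pⱼ≢rⱼ ∘ trans pⱼ≡qⱼ)
      sp : DimEdge j s p
      sp = agreeOutside⇒dimEdge (agreeOutside-sym (agreeOutside-trans p~r r~s))
             (≢-≢⇒≡ (proj₁ rs ∘ sym) (pᵢ≢rᵢ ∘ sym))
             (λ sⱼ≡pⱼ → pⱼ≢rⱼ (sym (trans rⱼ≡sⱼ sⱼ≡pⱼ)))
    ... | yes pᵢ≡rᵢ | no pⱼ≢rⱼ =
      inj₂ (dimEdges⇒4Cycle i≢j pq qs (dimEdge-sym {u = r} {v = s} rs) rp)
      where
      qs : DimEdge j q s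
      qs = agreeOutside⇒dimEdge (agreeOutside-trans q~p (agreeOutside-trans p~r r~s))
             (≢-≢⇒≡ (λ qᵢ≡rᵢ → proj₁ pq (trans pᵢ≡rᵢ (sym qᵢ≡rᵢ))) (proj₁ rs))
             (λ qⱼ≡sⱼ → pⱼ≢rⱼ (trans pⱼ≡qⱼ (trans qⱼ≡sⱼ (sym rⱼ≡sⱼ))))
      rp : DimEdge j r p
      rp = agreeOutside⇒dimEdge (agreeOutside-sym p~r) (sym pᵢ≡rᵢ) (pⱼ≢rⱼ ∘ sym)

punchIn-punchIn-onto : ∀ {k} (i : Fin (suc (suc k))) (j : Fin (suc k)) l →
  l ≢ i → l ≢ punchIn i j → ∃ λ t → punchIn i (punchIn j t) ≡ l
punchIn-punchIn-onto i j l l≢i l≢iⱼ = punchOut l′≢j , (begin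
  punchIn i (punchIn j (punchOut l′≢j)) ≡⟨ cong (punchIn i) (punchIn-punchOut l′≢j) ⟩
  punchIn i l′                          ≡⟨ punchIn-punchOut (l≢i ∘ sym) ⟩
  l                                     ∎)
  where
  open ≡-Reasoning
  l′ = punchOut (l≢i ∘ sym)
  l′≢j : j ≢ l′
  l′≢j j≡l′ = l≢iⱼ (trans (sym (punchIn-punchOut (l≢i ∘ sym)))
                          (cong (punchIn i) (sym j≡l′)))

module _ {k : ℕ} (i : Fin (suc (suc k))) (j : Fin (suc k)) where

  private
    bit : Bool ↣ Fin 2
    bit = ↔⇒↣ (↔-sym 2↔Bool)

  offPattern : Vertex (suc (suc k)) → Fin (2 ^ k)
  offPattern v = funToFin (λ t → Injection.to bit (lookup v (punchIn i (punchIn j t))))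

  offPattern⇒agreeOutside : ∀ {u v} → offPattern u ≡ offPattern v →
                            AgreeOutside i (punchIn i j) u v
  offPattern⇒agreeOutside {u} {v} eq = agreeOutside agree
    where
    agree : ∀ l → l ≢ i → l ≢ punchIn i j → lookup u l ≡ lookup v l
    agree l l≢i l≢iⱼ with punchIn-punchIn-onto i j l l≢i l≢iⱼ
    ... | t , refl = Injection.injective bit (begin
      _ ≡⟨ finToFun-funToFin _ t ⟨
      finToFun (offPattern u) t ≡⟨ cong (λ x → finToFun x t) eq ⟩
      finToFun (offPattern v) t ≡⟨ finToFun-funToFin _ t ⟩
      _ ∎)
      where open ≡-Reasoning

module _ (n : ℕ) where

  private instance
    2ⁿ≢0 : NonZero (2 ^ n)
    2ⁿ≢0 = m^n≢0 2 n

  3≤2ⁿ : 2 ≤ n → 3 ≤ 2 ^ n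
  3≤2ⁿ 2≤n = ≤-trans (s≤s (s≤s (s≤s z≤n))) (^-monoʳ-≤ 2 2≤n)

  cycleEdge-not-reversed : ∀ {A : Set} {h : Fin (2 ^ n) → A} → Injective _≡_ _≡_ h →
    2 ≤ n → ∀ a b → ¬ (h a ≡ h (next n b) × h (next n a) ≡ h b)
  cycleEdge-not-reversed h-injective 2≤n a b (a≡b⁺ , a⁺≡b) =
    sucMod∘sucMod≢id (2 ^ n) (3≤2ⁿ 2≤n) b
      (trans (cong (next n) (sym (h-injective a≡b⁺))) (h-injective a⁺≡b))

  module _ (h : Fin (2 ^ n) → Vertex n) (i : Fin n) where

    private
      isDimEdge? : Decidable (λ ι → DimEdge i (h ι) (h (next n ι)))
      isDimEdge? ι = dimEdge? i (h ι) (h (next n ι))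

      starts : List (Fin (2 ^ n))
      starts = filter isDimEdge? (allFinL (2 ^ n))

      starts-dimEdge : ∀ x → let a = List.lookup starts x in DimEdge i (h a) (h (next n a))
      starts-dimEdge x = proj₂ (∈-filter⁻ isDimEdge? {xs = allFinL (2 ^ n)} (∈-lookup x))

    dimEdges-pigeonhole : ∀ {m} (f : Fin (2 ^ n) → Fin m) → m < colourCount n h i →
        ∃ λ a → ∃ λ b → a ≢ b × DimEdge i (h a) (h (next n a)) × DimEdge i (h b) (h (next n b))
                    × f a ≡ f b
    dimEdges-pigeonhole f m<cᵢ with x , y , x<y , fx≡fy ← pigeonhole m<cᵢ (f ∘ List.lookup starts) =
      List.lookup starts x , List.lookup starts y ,
      AllPairs-lookup (filter⁺ isDimEdge? (allFin⁺ (2 ^ n))) x<y ,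
      starts-dimEdge x , starts-dimEdge y , fx≡fy

theorem3 : (n : ℕ) → 2 ≤ n → (h : Fin (2 ^ n) → Vertex n) → IsHamCycle n h →
    (i : Fin n) → 2 ^ (n ∸ 2) < colourCount n h i → HasSquareWithRims n h i
theorem3 n 2≤n@(s≤s (s≤s _)) h (h-injective , _) i 2ⁿ⁻²<cᵢ
  with a , b , a≢b , aᵢ , bᵢ , samePattern
         ← dimEdges-pigeonhole n h i (offPattern i zero ∘ h) 2ⁿ⁻²<cᵢ =
  a , b , aᵢ , bᵢ ,
  parallelEdges⇒square (punchInᵢ≢i i zero ∘ sym) aᵢ bᵢ
    (offPattern⇒agreeOutside i zero samePattern) (a≢b ∘ h-injective)
    (cycleEdge-not-reversed n h-injective 2≤n a b)
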